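{- Let $k\ge1$ and $0\le\ell<2k$ be integers and $G=(V,E)$ a multigraph on $n$ vertices, with $n\ge1$ if $\ell\le k$ and $n\ge2$ if $\ell>k$. At any moment during the execution of the basic $(k,\ell)$-pebble game on $G$, for any subset $V'\subseteq V$ with $n'=|V'|$ vertices ($n'\ge1$ if $\ell\le k$, $n'\ge2$ if $\ell>k$), $V'$ spans a block of the (undirected) graph of accepted edges $D$, i.e. $span(V')=kn'-\ell$, if and only if $peb(V')+out(V')=\ell$.
   Context: Basic $(k,\ell)$-pebble game: maintain a directed multigraph $D$ on $V$, initially with no edges, and a number $peb(w)$ of free pebbles on each vertex $w$, initially $k$. Process the edges of $G$ one at a time in an arbitrary order. For the current edge $e=uv$ (possibly $u=v$), let $P=peb(u)+peb(v)$ if $u\ne v$ and $P=peb(u)$ if $u=v$. While $P<\ell+1$, try a pebble collection move: find a directed path in $D$ from some $x\in\{u,v\}$ to a vertex $w\notin\{u,v\}$ with $peb(w)\ge1$; reverse every edge on the path, decrease $peb(w)$ by 1, increase $peb(x)$ by 1. If $P<\ell+1$ and no such path exists, $e$ is rejected. Once $P\ge\ell+1$, $e$ is accepted: choose an endpoint, say $u$, with $peb(u)\ge1$, insert $u\to v$ into $D$ (a loop if $u=v$) and decrease $peb(u)$ by 1. Notation: $peb(V')=\sum_{v\in V'}peb(v)$ (free pebbles); $span(V')$ is the number of edges of $D$ (including loops) with both endpoints in $V'$; $out(V')$ is the number of edges of $D$ from $V'$ to $V\setminus V'$. In a $(k,\ell)$-sparse graph (every set of $n'$ vertices spans at most $\max\{0,kn'-\ell\}$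 edges), a block is the subgraph induced by a vertex set $V'$ spanning exactly $k|V'|-\ell$ edges. -}

module Defs where

open import Data.Nat using (ℕ; zero; suc; _+_; _∸_; _≤_; _<_)
open import Data.Bool using (Bool; true; false; if_then_else_; _∧_; not)
open import Data.Fin using (Fin; _≟_)
open import Data.Fin.Subset using (Subset)
open import Data.Vec using (lookup)
open import Data.List using (List; []; _∷_; length; map; allFin; tabulate)
open import Data.Nat.ListAction using (sum)
import Data.List as L
open import Data.List.Relation.Unary.Unique.Propositional using (Unique)
open import Data.Product using (_×_; _,_; proj₁; proj₂; ∃; ∃-syntax; Σ)
open import Data.Sum using (_⊎_)
open import Relation.Nullary using (¬_; does)
open import Relation.Binary.PropositionalEquality using (_≡_; _≢_)

-- Vertices of the multigraph are Fin n.  A (directed) edge is an ordered pair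
-- (tail , head); undirected edges of G are pairs (u , v), loops allowed (u = v).
Edge : ℕ → Set
Edge n = Fin n × Fin n

count : {A : Set} → (A → Bool) → List A → ℕ
count p [] = 0
count p (x ∷ xs) = if p x then suc (count p xs) else count p xs

inS : {n : ℕ} → Subset n → Fin n → Bool
inS V' v = lookup V' v

pebS : {n : ℕ} → (Fin n → ℕ) → Subset n → ℕ
pebS {n} peb V' = sum (map (λ v → if inS V' v then peb v else 0) (allFin n))

span : {n : ℕ} → List (Edge n) → Subset n → ℕ
span D V' = count (λ e → inS V' (proj₁ e) ∧ inS V' (proj₂ e)) D

out : {n : ℕ} → List (Edge n) → Subset n → ℕ
out D V' = count (λ e → inS V' (proj₁ e) ∧ not (inS V' (proj₂ e))) D

-- Game configuration: directed multigraph D (list of directed edges) and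
-- the free pebble counts.
record Config (n : ℕ) : Set where
  constructor config
  field
    D   : List (Edge n)
    peb : Fin n → ℕ
open Config public

Pval : {n : ℕ} → (Fin n → ℕ) → Edge n → ℕ
Pval peb (u , v) = if does (u ≟ v) then peb u else peb u + peb v

-- A directed walk in D from x to w, recorded by the positions (in D) of its edges.
data Walk {n : ℕ} (D : List (Edge n)) : Fin n → Fin n → List (Fin (length D)) → Set where
  stop : ∀ {x} → Walk D x x []
  step : ∀ {x y w is} (i : Fin (length D)) → L.lookup D i ≡ (x , y) →
         Walk D y w is → Walk D x w (i ∷ is)

walkVerts : ∀ {n} {D : List (Edge n)} {x w is} → Walk D x w is → List (Fin n)
walkVerts {x = x} stop = x ∷ []
walkVerts {x = x} (step i _ p) = x ∷ walkVerts p

Path : ∀ {n} (D : List (Edge n)) → Fin n → Fin n → List (Fin (length D)) → Set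
Path D x w is = Σ (Walk D x w is) (λ p → Unique (walkVerts p))

memb : ∀ {m} → Fin m → List (Fin m) → Bool
memb i [] = false
memb i (j ∷ js) = if does (i ≟ j) then true else memb i js

swapE : ∀ {n} → Edge n → Edge n
swapE (a , b) = (b , a)

reverseAt : ∀ {n} (D : List (Edge n)) → List (Fin (length D)) → List (Edge n)
reverseAt D is = tabulate (λ j → if memb j is then swapE (L.lookup D j) else L.lookup D j)

movePeb : ∀ {n} → (Fin n → ℕ) → Fin n → Fin n → Fin n → ℕ
movePeb peb w x y =
  if does (y ≟ w) then peb y ∸ 1 else (if does (y ≟ x) then suc (peb y) else peb y)

data Collect {n : ℕ} (e : Edge n) (c : Config n) : Config n → Set where
  collect : (x w : Fin n) → (x ≡ proj₁ e ⊎ x ≡ proj₂ e) →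
            w ≢ proj₁ e → w ≢ proj₂ e → 1 ≤ peb c w →
            (is : List (Fin (length (D c)))) → Path (D c) x w is →
            Collect e c (config (reverseAt (D c) is) (movePeb (peb c) w x))

decPeb : ∀ {n} → (Fin n → ℕ) → Fin n → Fin n → ℕ
decPeb peb a y = if does (y ≟ a) then peb y ∸ 1 else peb y

-- Reach k ℓ E rest c : configuration c occurs during the game, and rest is
-- the list of edges not yet accepted/rejected (its head being the current edge).
data Reach {n : ℕ} (k ℓ : ℕ) (E : List (Edge n)) : List (Edge n) → Config n → Set where
  init    : Reach k ℓ E E (config [] (λ _ → k))
  collectR : ∀ {e rest c c'} → Reach k ℓ E (e ∷ rest) c →
             Pval (peb c) e < suc ℓ → Collect e c c' → Reach k ℓ E (e ∷ rest) c'
  reject  : ∀ {e rest c} → Reach k ℓ E (e ∷ rest) c →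
             Pval (peb c) e < suc ℓ → ¬ (∃[ c' ] Collect e c c') → Reach k ℓ E rest c
  acceptU : ∀ {u v rest c} → Reach k ℓ E ((u , v) ∷ rest) c →
             suc ℓ ≤ Pval (peb c) (u , v) → 1 ≤ peb c u →
             Reach k ℓ E rest (config ((u , v) ∷ D c) (decPeb (peb c) u))
  acceptV : ∀ {u v rest c} → Reach k ℓ E ((u , v) ∷ rest) c →
             suc ℓ ≤ Pval (peb c) (u , v) → 1 ≤ peb c v →
             Reach k ℓ E rest (config ((v , u) ∷ D c) (decPeb (peb c) v))

{-# OPTIONS --safe #-}
module Submission where

-- Each vertex always owns exactly k pebbles: its free pebbles plus one for each of its
-- out-edges in D.  Accepting an edge spends a free pebble of its tail, and a collection
-- move along a path from x to w turns an out-edge of x into one of w (inner vertices keep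
-- their out-degree) while a free pebble moves from w to x.  Summing over V', each out-edge
-- of a vertex of V' is either spanned by V' or leaves it, so peb(V') + span(V') + out(V')
-- = k n'.  The size hypotheses give ℓ ≤ k n', and the equivalence is then arithmetic.

open import Defs
open import Data.Nat using (ℕ; zero; suc; _+_; _*_; _∸_; _≤_; _<_; _≤?_)
open import Data.Nat.Properties
  using ( +-0-commutativeMonoid; +-commutativeSemigroup; +-identityʳ; +-comm; +-assoc; +-suc
        ; +-cancelʳ-≡; m+[n∸m]≡n; m+n∸n≡m; *-identityʳ; *-zeroʳ; *-suc; *-comm; *-monoʳ-≤
        ; ≤-trans; ≤-reflexive; <⇒≤; ≰⇒> )
open import Data.Nat.ListAction using (sum)
open import Data.Bool using (Bool; true; false; if_then_else_; _∧_; not)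
open import Data.Fin using (Fin; zero; suc; _≟_)
open import Data.Fin.Subset using (Subset; ∣_∣)
import Data.Vec as Vec
open import Data.List using (List; []; _∷_; map; tabulate)
import Data.List as L
open import Data.List.Properties using (map-tabulate; tabulate-lookup)
open import Data.List.Membership.Propositional using (_∈_)
open import Data.List.Relation.Unary.Any using (here; there)
open import Data.List.Relation.Unary.All as All using (All; []; _∷_)
open import Data.List.Relation.Unary.AllPairs using ([]; _∷_)
open import Data.List.Relation.Unary.Unique.Propositional using (Unique)
open import Data.Product using (_,_; proj₁; proj₂)
open import Data.Sum using ([_,_])
open import Data.Empty using (⊥-elim)
open import Function.Base using (_∘_; const)
open import Function.Bundles using (_⇔_; mk⇔)
open import Relation.Nullary using (does; yes; no)
open import Relation.Binary.PropositionalEquality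
  using (_≡_; _≢_; refl; sym; trans; cong; cong₂; subst; module ≡-Reasoning)
open ≡-Reasoning
open import Algebra.Properties.CommutativeMonoid.Sum +-0-commutativeMonoid
  using (sum-cong-≗; ∑-distrib-+; sum-replicate-zero) renaming (sum to ∑)
open import Algebra.Properties.CommutativeSemigroup +-commutativeSemigroup
  using (xy∙z≈xz∙y; x∙yz≈xz∙y; xy∙z≈z∙yx; interchange; x∙yz≈y∙xz)

𝟙 : Bool → ℕ
𝟙 b = if b then 1 else 0

restrict : ∀ {m} → (Fin m → Bool) → (Fin m → ℕ) → Fin m → ℕ
restrict S f j = if S j then f j else 0

∑-δ : ∀ {m} (f : Fin m → ℕ) (i : Fin m) → ∑ (restrict (λ j → does (j ≟ i)) f) ≡ f i
∑-δ {suc m} f zero    = trans (cong (f zero +_) (sum-replicate-zero m)) (+-identityʳ (f zero))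
∑-δ {suc m} f (suc i) = ∑-δ (f ∘ suc) i

memb≡false : ∀ {m} {i : Fin m} {is : List (Fin m)} → All (i ≢_) is → memb i is ≡ false
memb≡false [] = refl
memb≡false {i = i} {j ∷ _} (i≢j ∷ i∉is) with i ≟ j
... | yes i≡j = ⊥-elim (i≢j i≡j)
... | no _    = memb≡false i∉is

∑-memb : ∀ {m} (f : Fin m → ℕ) {is : List (Fin m)} → Unique is →
         ∑ (restrict (λ j → memb j is) f) ≡ sum (map f is)
∑-memb {m} f {[]} [] = sum-replicate-zero m
∑-memb f {i ∷ is} (i∉is ∷ u) = begin
  ∑ (restrict (λ j → memb j (i ∷ is)) f) ≡⟨ sum-cong-≗ split ⟩
  ∑ (λ j → atᵢ j + onIs j)                ≡⟨ ∑-distrib-+ atᵢ onIs ⟩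
  ∑ atᵢ + ∑ onIs                           ≡⟨ cong₂ _+_ (∑-δ f i) (∑-memb f u) ⟩
  f i + sum (map f is)                     ∎
  where
  atᵢ onIs : Fin _ → ℕ
  atᵢ  = restrict (λ j → does (j ≟ i)) f
  onIs = restrict (λ j → memb j is) f
  split : ∀ j → restrict (λ j → memb j (i ∷ is)) f j ≡ atᵢ j + onIs j
  split j with j ≟ i
  ... | yes refl rewrite memb≡false i∉is = sym (+-identityʳ (f j))
  ... | no _     = refl

sum-tabulate : ∀ {m} (f : Fin m → ℕ) → sum (tabulate f) ≡ ∑ f
sum-tabulate {zero}  f = refl
sum-tabulate {suc m} f = cong (f zero +_) (sum-tabulate (f ∘ suc))

count-∷ : ∀ {A : Set} (q : A → Bool) x xs → count q (x ∷ xs) ≡ 𝟙 (q x) + count q xs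
count-∷ q x xs with q x
... | true  = refl
... | false = refl

count-tabulate : ∀ {A : Set} {m} (q : A → Bool) (f : Fin m → A) →
                 count q (tabulate f) ≡ ∑ (𝟙 ∘ q ∘ f)
count-tabulate {m = zero}  q f = refl
count-tabulate {m = suc m} q f = trans (count-∷ q (f zero) (tabulate (f ∘ suc)))
                                       (cong (𝟙 (q (f zero)) +_) (count-tabulate q (f ∘ suc)))

count-lookup : ∀ {A : Set} (q : A → Bool) (xs : List A) → count q xs ≡ ∑ (𝟙 ∘ q ∘ L.lookup xs)
count-lookup q xs = trans (cong (count q) (sym (tabulate-lookup xs)))
                          (count-tabulate q (L.lookup xs))

count-∧-split : ∀ {A : Set} (a b : A → Bool) (xs : List A) →
                count (λ x → a x ∧ b x) xs + count (λ x → a x ∧ not (b x)) xs ≡ count a xs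
count-∧-split a b [] = refl
count-∧-split a b (x ∷ xs) with a x | b x
... | true  | true  = cong suc (count-∧-split a b xs)
... | true  | false = trans (+-suc (count (λ x → a x ∧ b x) xs) (count (λ x → a x ∧ not (b x)) xs))
                            (cong suc (count-∧-split a b xs))
... | false | _     = count-∧-split a b xs

count-reverseAt : ∀ {n} (q : Edge n → Bool) (D : List (Edge n)) {is} → Unique is →
                  count q (reverseAt D is) + sum (map (𝟙 ∘ q ∘ L.lookup D) is)
                  ≡ count q D + sum (map (𝟙 ∘ q ∘ swapE ∘ L.lookup D) is)
count-reverseAt q D {is} u = begin
  count q (reverseAt D is) + sum (map t is)  ≡⟨ cong₂ _+_ (count-tabulate q flipped) (sym (∑-memb t u)) ⟩
  ∑ r + ∑ (onIs t)                           ≡⟨ ∑-distrib-+ r (onIs t) ⟨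
  ∑ (λ j → r j + onIs t j)                   ≡⟨ sum-cong-≗ exchange ⟩
  ∑ (λ j → t j + onIs h j)                   ≡⟨ ∑-distrib-+ t (onIs h) ⟩
  ∑ t + ∑ (onIs h)                           ≡⟨ cong₂ _+_ (sym (count-lookup q D)) (∑-memb h u) ⟩
  count q D + sum (map h is)                 ∎
  where
  flipped : Fin (L.length D) → Edge _
  flipped j = if memb j is then swapE (L.lookup D j) else L.lookup D j
  onIs : (Fin (L.length D) → ℕ) → Fin (L.length D) → ℕ
  onIs = restrict (λ j → memb j is)
  t h r : Fin (L.length D) → ℕ
  t = 𝟙 ∘ q ∘ L.lookup D
  h = 𝟙 ∘ q ∘ swapE ∘ L.lookup D
  r = 𝟙 ∘ q ∘ flipped
  exchange : ∀ j → r j + onIs t j ≡ t j + onIs h j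
  exchange j with memb j is
  ... | true  = +-comm (h j) (t j)
  ... | false = refl

tailsIn : ∀ {n} → (Fin n → Bool) → List (Edge n) → ℕ
tailsIn S = count (S ∘ proj₁)

module _ {n : ℕ} {D : List (Edge n)} where

  tailsAt headsAt : (Fin n → Bool) → List (Fin (L.length D)) → ℕ
  tailsAt P is = sum (map (𝟙 ∘ P ∘ proj₁ ∘ L.lookup D) is)
  headsAt P is = sum (map (𝟙 ∘ P ∘ proj₂ ∘ L.lookup D) is)

  tail∈walkVerts : ∀ {x w is i} (p : Walk D x w is) → i ∈ is → proj₁ (L.lookup D i) ∈ walkVerts p
  tail∈walkVerts (step i eq p) (here refl)  = here (cong proj₁ eq)
  tail∈walkVerts (step i eq p) (there i∈is) = there (tail∈walkVerts p i∈is)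

  -- reverseAt flips a listed position only once, so reversing a walk needs distinct positions.
  walk-edges-unique : ∀ {x w is} (p : Walk D x w is) → Unique (walkVerts p) → Unique is
  walk-edges-unique stop _ = []
  walk-edges-unique (step i eq p) (x∉p ∷ u) = All.tabulate i∉is ∷ walk-edges-unique p u
    where
    i∉is : ∀ {j} → j ∈ _ → i ≢ j
    i∉is j∈is refl =
      All.lookup x∉p (subst (_∈ walkVerts p) (cong proj₁ eq) (tail∈walkVerts p j∈is)) refl

  walk-telescope : ∀ (P : Fin n → Bool) {x w is} → Walk D x w is →
                   headsAt P is + 𝟙 (P x) ≡ tailsAt P is + 𝟙 (P w)
  walk-telescope P stop = refl
  walk-telescope P {x} {w} (step {y = y} {is = is} i eq p) = begin
    𝟙 (P (proj₂ (L.lookup D i))) + H + 𝟙 (P x) ≡⟨ cong (λ e → 𝟙 (P (proj₂ e)) + H + 𝟙 (P x)) eq ⟩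
    𝟙 (P y) + H + 𝟙 (P x)                      ≡⟨ xy∙z≈z∙yx (𝟙 (P y)) H (𝟙 (P x)) ⟩
    𝟙 (P x) + (H + 𝟙 (P y))                    ≡⟨ cong (𝟙 (P x) +_) (walk-telescope P p) ⟩
    𝟙 (P x) + (T + 𝟙 (P w))                    ≡⟨ +-assoc (𝟙 (P x)) T (𝟙 (P w)) ⟨
    𝟙 (P x) + T + 𝟙 (P w)                      ≡⟨ cong (λ e → 𝟙 (P (proj₁ e)) + T + 𝟙 (P w)) eq ⟨
    𝟙 (P (proj₁ (L.lookup D i))) + T + 𝟙 (P w) ∎
    where
    H T : ℕ
    H = headsAt P is
    T = tailsAt P is

  tailsIn-reverse-path : ∀ (P : Fin n → Bool) {x w is} → Path D x w is →
                         tailsIn P (reverseAt D is) + 𝟙 (P x) ≡ tailsIn P D + 𝟙 (P w)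
  tailsIn-reverse-path P {x} {w} {is} (p , u) = +-cancelʳ-≡ T _ _ (begin
    R + 𝟙 (P x) + T         ≡⟨ xy∙z≈xz∙y R (𝟙 (P x)) T ⟩
    R + T + 𝟙 (P x)         ≡⟨ cong (_+ 𝟙 (P x)) (count-reverseAt (P ∘ proj₁) D (walk-edges-unique p u)) ⟩
    C + H + 𝟙 (P x)         ≡⟨ +-assoc C H (𝟙 (P x)) ⟩
    C + (H + 𝟙 (P x))       ≡⟨ cong (C +_) (walk-telescope P p) ⟩
    C + (T + 𝟙 (P w))       ≡⟨ x∙yz≈xz∙y C T (𝟙 (P w)) ⟩
    C + 𝟙 (P w) + T         ∎)
    where
    R C H T : ℕ
    R = tailsIn P (reverseAt D is)
    C = tailsIn P D
    H = headsAt P is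
    T = tailsAt P is

outdeg : ∀ {n} → List (Edge n) → Fin n → ℕ
outdeg D v = tailsIn (λ u → does (v ≟ u)) D

PebblesConserved : ∀ {n} → ℕ → Config n → Set
PebblesConserved {n} k c = ∀ (v : Fin n) → peb c v + outdeg (D c) v ≡ k

decPeb-+𝟙 : ∀ {n} (peb : Fin n → ℕ) {a} → 1 ≤ peb a →
            ∀ v → decPeb peb a v + 𝟙 (does (v ≟ a)) ≡ peb v
decPeb-+𝟙 peb {a} 1≤a v with v ≟ a
... | yes refl = trans (+-comm (peb v ∸ 1) 1) (m+[n∸m]≡n 1≤a)
... | no _     = +-identityʳ (peb v)

movePeb-+𝟙 : ∀ {n} (peb : Fin n → ℕ) {w x} → 1 ≤ peb w → x ≢ w →
             ∀ v → movePeb peb w x v + 𝟙 (does (v ≟ w)) ≡ peb v + 𝟙 (does (v ≟ x))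
movePeb-+𝟙 peb {w} {x} 1≤w x≢w v with v ≟ w | v ≟ x
... | yes refl | yes refl = ⊥-elim (x≢w refl)
... | yes refl | no _     = trans (+-comm (peb v ∸ 1) 1) (trans (m+[n∸m]≡n 1≤w) (sym (+-identityʳ (peb v))))
... | no _     | yes refl = trans (+-identityʳ (suc (peb v))) (+-comm 1 (peb v))
... | no _     | no _     = refl

accept-conserves : ∀ {n k} {c : Config n} {a b} → 1 ≤ peb c a → PebblesConserved k c →
                   PebblesConserved k (config ((a , b) ∷ D c) (decPeb (peb c) a))
accept-conserves {k = k} {c} {a} {b} 1≤a conserved v = begin
  decPeb (peb c) a v + outdeg ((a , b) ∷ D c) v
    ≡⟨ cong (decPeb (peb c) a v +_) (count-∷ _ (a , b) (D c)) ⟩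
  decPeb (peb c) a v + (𝟙 (does (v ≟ a)) + outdeg (D c) v)
    ≡⟨ sym (+-assoc (decPeb (peb c) a v) _ _) ⟩
  decPeb (peb c) a v + 𝟙 (does (v ≟ a)) + outdeg (D c) v
    ≡⟨ cong (_+ outdeg (D c) v) (decPeb-+𝟙 (peb c) 1≤a v) ⟩
  peb c v + outdeg (D c) v
    ≡⟨ conserved v ⟩
  k ∎

collect-conserves : ∀ {n k e} {c c' : Config n} → Collect e c c' → PebblesConserved k c →
                    PebblesConserved k c'
collect-conserves {k = k} {c = c} (collect x w x∈e w≢u w≢v 1≤w is path) conserved v =
  +-cancelʳ-≡ (X + W) _ _ (begin
    p' + o' + (X + W) ≡⟨ cong (p' + o' +_) (+-comm X W) ⟩
    p' + o' + (W + X) ≡⟨ interchange p' o' W X ⟩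
    p' + W + (o' + X) ≡⟨ cong₂ _+_ (movePeb-+𝟙 (peb c) 1≤w x≢w v)
                                   (tailsIn-reverse-path (λ u → does (v ≟ u)) path) ⟩
    p + X + (o + W)   ≡⟨ interchange p X o W ⟩
    p + o + (X + W)   ≡⟨ cong (_+ (X + W)) (conserved v) ⟩
    k + (X + W)       ∎)
  where
  p o p' o' X W : ℕ
  p  = peb c v
  o  = outdeg (D c) v
  p' = movePeb (peb c) w x v
  o' = outdeg (reverseAt (D c) is) v
  X  = 𝟙 (does (v ≟ x))
  W  = 𝟙 (does (v ≟ w))
  x≢w : x ≢ w
  x≢w refl = [ w≢u , w≢v ] x∈e

reachable-conserves : ∀ {n k ℓ} {E rest : List (Edge n)} {c} → Reach k ℓ E rest c →
                      PebblesConserved k c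
reachable-conserves init               v = +-identityʳ _
reachable-conserves (collectR r _ col) = collect-conserves col (reachable-conserves r)
reachable-conserves (reject r _ _)     = reachable-conserves r
reachable-conserves (acceptU {u} {v} {c = c} r _ 1≤u) =
  accept-conserves {c = c} {u} {v} 1≤u (reachable-conserves r)
reachable-conserves (acceptV {u} {v} {c = c} r _ 1≤v) =
  accept-conserves {c = c} {v} {u} 1≤v (reachable-conserves r)

tailsIn-∑-outdeg : ∀ {n} (S : Fin n → Bool) (D : List (Edge n)) →
                   tailsIn S D ≡ ∑ (restrict S (outdeg D))
tailsIn-∑-outdeg {n} S [] = sym (trans (sum-cong-≗ restrict-0) (sum-replicate-zero n))
  where
  restrict-0 : ∀ v → restrict S (const 0) v ≡ 0
  restrict-0 v with S v
  ... | true  = refl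
  ... | false = refl
tailsIn-∑-outdeg S ((a , b) ∷ D) = begin
  tailsIn S ((a , b) ∷ D)
    ≡⟨ count-∷ (S ∘ proj₁) (a , b) D ⟩
  𝟙 (S a) + tailsIn S D
    ≡⟨ cong₂ _+_ (sym (∑-δ (𝟙 ∘ S) a)) (tailsIn-∑-outdeg S D) ⟩
  ∑ atₐ + ∑ (restrict S (outdeg D))
    ≡⟨ ∑-distrib-+ atₐ (restrict S (outdeg D)) ⟨
  ∑ (λ v → atₐ v + restrict S (outdeg D) v)
    ≡⟨ sum-cong-≗ split ⟨
  ∑ (restrict S (outdeg ((a , b) ∷ D))) ∎
  where
  atₐ : Fin _ → ℕ
  atₐ = restrict (λ v → does (v ≟ a)) (𝟙 ∘ S)
  split : ∀ v → restrict S (outdeg ((a , b) ∷ D)) v ≡ atₐ v + restrict S (outdeg D) v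
  split v with S v | v ≟ a
  ... | true  | yes refl = refl
  ... | true  | no _     = refl
  ... | false | yes refl = refl
  ... | false | no _     = refl

pebS-∑ : ∀ {n} (peb : Fin n → ℕ) (V' : Subset n) → pebS peb V' ≡ ∑ (restrict (inS V') peb)
pebS-∑ peb V' = trans (cong sum (map-tabulate (λ v → v) (restrict (inS V') peb)))
                      (sum-tabulate (restrict (inS V') peb))

∑-restrict-const : ∀ {n} k (V' : Subset n) → ∑ (restrict (inS V') (const k)) ≡ k * ∣ V' ∣
∑-restrict-const k Vec.[]            = sym (*-zeroʳ k)
∑-restrict-const k (true  Vec.∷ V') = trans (cong (k +_) (∑-restrict-const k V')) (sym (*-suc k _))
∑-restrict-const k (false Vec.∷ V') = ∑-restrict-const k V'

peb+span+out≡k*∣V'∣ : ∀ {n k} (c : Config n) (V' : Subset n) → PebblesConserved k c →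
               pebS (peb c) V' + (span (D c) V' + out (D c) V') ≡ k * ∣ V' ∣
peb+span+out≡k*∣V'∣ {k = k} c V' conserved = begin
  pebS (peb c) V' + (span (D c) V' + out (D c) V')
    ≡⟨ cong₂ _+_ (pebS-∑ (peb c) V') (count-∧-split (S ∘ proj₁) (S ∘ proj₂) (D c)) ⟩
  ∑ (restrict S (peb c)) + tailsIn S (D c)
    ≡⟨ cong (∑ (restrict S (peb c)) +_) (tailsIn-∑-outdeg S (D c)) ⟩
  ∑ (restrict S (peb c)) + ∑ (restrict S (outdeg (D c)))
    ≡⟨ ∑-distrib-+ (restrict S (peb c)) (restrict S (outdeg (D c))) ⟨
  ∑ (λ v → restrict S (peb c) v + restrict S (outdeg (D c)) v)
    ≡⟨ sum-cong-≗ each-vertex ⟩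
  ∑ (restrict S (const k))
    ≡⟨ ∑-restrict-const k V' ⟩
  k * ∣ V' ∣ ∎
  where
  S : Fin _ → Bool
  S = inS V'
  each-vertex : ∀ v → restrict S (peb c) v + restrict S (outdeg (D c)) v ≡ restrict S (const k) v
  each-vertex v with S v
  ... | true  = conserved v
  ... | false = refl

s≡N∸ℓ⇔p+o≡ℓ : ∀ p s o {N ℓ} → ℓ ≤ N → p + (s + o) ≡ N → (s ≡ N ∸ ℓ) ⇔ (p + o ≡ ℓ)
s≡N∸ℓ⇔p+o≡ℓ p s o {N} {ℓ} ℓ≤N total = mk⇔ to from
  where
  to : s ≡ N ∸ ℓ → p + o ≡ ℓ
  to s≡N∸ℓ = +-cancelʳ-≡ s (p + o) ℓ (begin
    p + o + s      ≡⟨ x∙yz≈xz∙y p s o ⟨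
    p + (s + o)    ≡⟨ total ⟩
    N              ≡⟨ m+[n∸m]≡n ℓ≤N ⟨
    ℓ + (N ∸ ℓ)    ≡⟨ cong (ℓ +_) s≡N∸ℓ ⟨
    ℓ + s          ∎)
  from : p + o ≡ ℓ → s ≡ N ∸ ℓ
  from p+o≡ℓ = begin
    s                  ≡⟨ m+n∸n≡m s ℓ ⟨
    s + ℓ ∸ ℓ          ≡⟨ cong (λ m → s + m ∸ ℓ) p+o≡ℓ ⟨
    s + (p + o) ∸ ℓ    ≡⟨ cong (_∸ ℓ) (x∙yz≈y∙xz s p o) ⟩
    p + (s + o) ∸ ℓ    ≡⟨ cong (_∸ ℓ) total ⟩
    N ∸ ℓ              ∎

ℓ≤k*m : ∀ {k ℓ m} → ℓ < 2 * k → (ℓ ≤ k → 1 ≤ m) → (k < ℓ → 2 ≤ m) → ℓ ≤ k * m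
ℓ≤k*m {k} {ℓ} {m} ℓ<2k small large with ℓ ≤? k
... | yes ℓ≤k = ≤-trans ℓ≤k
                      (≤-trans (≤-reflexive (sym (*-identityʳ k))) (*-monoʳ-≤ k (small ℓ≤k)))
... | no ℓ≰k  = ≤-trans (<⇒≤ ℓ<2k)
                      (≤-trans (≤-reflexive (*-comm 2 k)) (*-monoʳ-≤ k (large (≰⇒> ℓ≰k))))

corollary11 : (k ℓ n : ℕ) → 1 ≤ k → ℓ < 2 * k →
              (ℓ ≤ k → 1 ≤ n) → (k < ℓ → 2 ≤ n) →
              (E : List (Edge n)) → (rest : List (Edge n)) → (c : Config n) →
              Reach k ℓ E rest c →
              (V' : Subset n) → (ℓ ≤ k → 1 ≤ ∣ V' ∣) → (k < ℓ → 2 ≤ ∣ V' ∣) →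
              (span (D c) V' ≡ k * ∣ V' ∣ ∸ ℓ) ⇔ (pebS (peb c) V' + out (D c) V' ≡ ℓ)
corollary11 k ℓ n _ ℓ<2k _ _ E rest c reach V' small large =
  s≡N∸ℓ⇔p+o≡ℓ (pebS (peb c) V') (span (D c) V') (out (D c) V')
    (ℓ≤k*m ℓ<2k small large) (peb+span+out≡k*∣V'∣ c V' (reachable-conserves reach))
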